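{- Let $n\ge1$ and let $\mathrm{BW}(n)=\{0,1\}^n$. Define $\eta:\mathrm{BW}(n)\to\mathrm{BW}(n)$ by $\eta(b_1,\dots,b_n)=(1-b_{n-1},1-b_n,b_1,b_2,\dots,b_{n-2})$. For any integer $m\ge 1$, with $d=\gcd(m,n)$, the number of words in $\mathrm{BW}(n)$ fixed by $\eta^{m}$ (the $m$-fold composition) is $2^d$ if $n/d$ is odd and $0$ otherwise. -}

module Defs where

open import Data.Bool using (Bool; true; false; not)
import Data.Bool.Properties as BoolP
open import Data.Nat using (ℕ; zero; suc; _≤_; _/_; ≢-nonZero; ≢-nonZero⁻¹; >-nonZero)
open import Data.Nat.GCD using (gcd; gcd[m,n]≢0)
open import Data.Sum using (inj₂)
open import Data.List using (List; []; _∷_; _++_; map; filter; length)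
open import Data.Vec using (Vec; []; _∷_; init; last)
open import Data.Vec.Properties using (≡-dec)

-- BW(n) = {0,1}^n, words of length n over Bool (false = 0, true = 1).
BW : ℕ → Set
BW n = Vec Bool n

-- η(b₁,…,bₙ) = (1 - bₙ₋₁, 1 - bₙ, b₁, …, bₙ₋₂)   (for n ≥ 2).
-- For n = 1 the formula degenerates; η is the identity (η is the square of the
-- negacyclic shift (b₁,…,bₙ) ↦ (1-bₙ,b₁,…,bₙ₋₁)).
η : ∀ {n} → BW n → BW n
η [] = []
η (b ∷ []) = b ∷ []
η {suc (suc k)} v = not (last (init v)) ∷ not (last v) ∷ init (init v)

iter : ∀ {A : Set} → ℕ → (A → A) → A → A
iter zero f x = x
iter (suc m) f x = f (iter m f x)

allWords : (n : ℕ) → List (BW n)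
allWords zero = [] ∷ []
allWords (suc n) = map (false ∷_) (allWords n) ++ map (true ∷_) (allWords n)

numFixed : (n m : ℕ) → ℕ
numFixed n m = length (filter (λ w → ≡-dec BoolP._≟_ (iter m η w) w) (allWords n))

nOverGcd : (m n : ℕ) → 1 ≤ n → ℕ
nOverGcd m n h = _/_ n (gcd m n) {{≢-nonZero (gcd[m,n]≢0 m n (inj₂ (≢-nonZero⁻¹ n {{>-nonZero h}})))}}

module Submission where

-- Let τ be the negacyclic rotation τ(b,w') = (w', 1-b) of Boolean
-- words, and read a word w as the Boolean stream S_w(j) = first letter of τʲ(w).
-- If w has length n ≥ 1 then S_w is n-antiperiodic, S_w(j+n) = ¬S_w(j), and w is
-- the first n terms of S_w.  Since τ² ∘ η = id and τ is injective, w is fixed by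
-- η^m iff τ^{2m}(w) = w iff S_w is 2m-periodic.  Put d = gcd(m,n), t = n/d.  By
-- Bézout, a stream that is 2m- and 2n-periodic is 2d-periodic.  If t is even then
-- n is a multiple of 2d, contradicting n-antiperiodicity: nothing is fixed.  If t
-- is odd then S_w is d-antiperiodic; conversely every d-antiperiodic stream is
-- n-antiperiodic and 2m-periodic.  So taking the first d resp. n terms puts the
-- fixed words in bijection with BW(d), and there are 2^d of them.

open import Data.Bool using (Bool; true; false; not)
open import Data.Bool.Properties using (not-involutive; not-¬; not-injective)
import Data.Bool.Properties as BoolP
open import Data.Nat using (ℕ; zero; suc; _+_; _*_; _∸_; _^_; _%_; _/_; _<_; _≤_; s≤s; z≤n; NonZero; ≢-nonZero; ≢-nonZero⁻¹; >-nonZero; >-nonZero⁻¹)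
open import Data.Nat.Properties
open import Data.Nat.DivMod using (m/n*n≡m; m≡m%n+[m/n]*n)
open import Data.Nat.Divisibility using (_∣_; divides)
open import Data.Nat.GCD using (gcd; gcd-GCD; gcd[m,n]∣m; gcd[m,n]∣n; gcd[m,n]≢0; c*gcd[m,n]≡gcd[cm,cn])
import Data.Nat.GCD as GCD
open import Data.Nat.Induction using (<-rec)
open import Data.Nat.Solver using (module +-*-Solver)
open import Data.List using (List; []; _∷_; _++_; map; filter; length; [_])
open import Data.List.Properties using (length-++; length-map; ++-assoc; ++-identityʳ; map-++; ++-conicalʳ; ∷ʳ-injective; filter-none)
open import Data.List.Membership.Propositional using (_∈_)
open import Data.List.Membership.Propositional.Properties using (∈-++⁺ˡ; ∈-++⁺ʳ; ∈-map⁺; ∈-map⁻; ∈-filter⁺; ∈-filter⁻)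
open import Data.List.Membership.Propositional.Properties.WithK using (unique∧set⇒bag)
open import Data.List.Relation.Binary.BagAndSetEquality using (∼bag⇒↭; _∼[_]_; set)
open import Data.List.Relation.Binary.Permutation.Propositional.Properties using (↭-length)
open import Data.List.Relation.Unary.Any using (here)
import Data.List.Relation.Unary.All as All
open import Data.List.Relation.Unary.AllPairs using ([]; _∷_)
open import Data.List.Relation.Unary.Unique.Propositional using (Unique)
import Data.List.Relation.Unary.Unique.Propositional.Properties as Unique
open import Data.Vec using (Vec; []; _∷_; toList; init; last; _∷ʳ_; initLast)
open import Data.Vec.Properties using (≡-dec; toList-injective; toList-∷ʳ; length-toList; ∷-injective)
open import Data.Vec.Relation.Binary.Equality.Cast using (cast-is-id)
open import Data.Product using (_×_; _,_; proj₂)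
open import Data.Sum using (inj₂)
open import Data.Empty using (⊥)
open import Function.Bundles using (mk⇔)
open import Relation.Nullary using (¬_; yes; no)
open import Level using (0ℓ)
open import Relation.Unary using (Pred; Decidable)
open import Relation.Binary.PropositionalEquality hiding ([_])
open ≡-Reasoning

open import Defs

iter-suc : ∀ {A : Set} (f : A → A) k x → iter (suc k) f x ≡ iter k f (f x)
iter-suc f zero    x = refl
iter-suc f (suc k) x = cong f (iter-suc f k x)

iter-+ : ∀ {A : Set} (f : A → A) j i x → iter (j + i) f x ≡ iter j f (iter i f x)
iter-+ f zero    i x = refl
iter-+ f (suc j) i x = cong f (iter-+ f j i x)

iter-twice : ∀ {A : Set} (f : A → A) k x → iter k (λ y → f (f y)) x ≡ iter (2 * k) f x
iter-twice f zero    x = refl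
iter-twice f (suc k) x =
  trans (cong (λ y → f (f y)) (iter-twice f k x)) (cong (λ i → iter i f x) (sym (*-suc 2 k)))

iter-commute : ∀ {A : Set} (f g : A → A) → (∀ x → f (g x) ≡ g (f x)) →
               ∀ k x → iter k f (g x) ≡ g (iter k f x)
iter-commute f g fg zero    x = refl
iter-commute f g fg (suc k) x = trans (cong f (iter-commute f g fg k x)) (fg _)

iter-injective : ∀ {A : Set} (f : A → A) → (∀ {x y} → f x ≡ f y → x ≡ y) →
                 ∀ k {x y} → iter k f x ≡ iter k f y → x ≡ y
iter-injective f inj zero    e = e
iter-injective f inj (suc k) e = iter-injective f inj k (inj e)

iter-undo : ∀ {A B : Set} (h : A → B) (f : A → A) (g : B → B) →
            (∀ a → g (h (f a)) ≡ h a) → ∀ k a → iter k g (h (iter k f a)) ≡ h a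
iter-undo h f g undo zero    a = refl
iter-undo h f g undo (suc k) a = begin
  iter (suc k) g (h (f (iter k f a)))  ≡⟨ iter-suc g k _ ⟩
  iter k g (g (h (f (iter k f a))))    ≡⟨ cong (iter k g) (undo _) ⟩
  iter k g (h (iter k f a))            ≡⟨ iter-undo h f g undo k a ⟩
  h a                                  ∎

Periodic : (ℕ → Bool) → ℕ → Set
Periodic S p = ∀ j → S (j + p) ≡ S j

Antiperiodic : (ℕ → Bool) → ℕ → Set
Antiperiodic S p = ∀ j → S (j + p) ≡ not (S j)

module _ {S : ℕ → Bool} where

  periodic-multiple : ∀ {p} → Periodic S p → ∀ q → Periodic S (q * p)
  periodic-multiple per zero    j = cong S (+-identityʳ j)
  periodic-multiple {p} per (suc q) j = begin
    S (j + (p + q * p))  ≡⟨ cong S (sym (+-assoc j p _)) ⟩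
    S (j + p + q * p)    ≡⟨ periodic-multiple per q (j + p) ⟩
    S (j + p)            ≡⟨ per j ⟩
    S j                  ∎

  periodic-difference : ∀ {a b c} → Periodic S b → Periodic S c → a + b ≡ c → Periodic S a
  periodic-difference {a} {b} {c} perb perc e j = begin
    S (j + a)      ≡⟨ sym (perb (j + a)) ⟩
    S (j + a + b)  ≡⟨ cong S (trans (+-assoc j a b) (cong (j +_) e)) ⟩
    S (j + c)      ≡⟨ perc j ⟩
    S j            ∎

  periodic-gcd : ∀ {a b} → Periodic S a → Periodic S b → Periodic S (gcd a b)
  periodic-gcd {a} {b} pera perb with GCD.Bézout.identity (gcd-GCD a b)
  ... | GCD.Bézout.+- x y eq =
    periodic-difference (periodic-multiple perb y) (periodic-multiple pera x) eq
  ... | GCD.Bézout.-+ x y eq =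
    periodic-difference (periodic-multiple pera x) (periodic-multiple perb y) eq

  antiperiodic-double : ∀ {p} → Antiperiodic S p → Periodic S (2 * p)
  antiperiodic-double {p} anti j = begin
    S (j + (p + (p + 0)))  ≡⟨ cong (λ i → S (j + (p + i))) (+-identityʳ p) ⟩
    S (j + (p + p))        ≡⟨ cong S (sym (+-assoc j p p)) ⟩
    S (j + p + p)          ≡⟨ anti (j + p) ⟩
    not (S (j + p))        ≡⟨ cong not (anti j) ⟩
    not (not (S j))        ≡⟨ not-involutive _ ⟩
    S j                    ∎

  antiperiodic-+-period : ∀ {p q} → Antiperiodic S p → Periodic S q → Antiperiodic S (p + q)
  antiperiodic-+-period {p} {q} anti per j =
    trans (cong S (sym (+-assoc j p q))) (trans (per (j + p)) (anti j))

  antiperiodic-∸-period : ∀ {p q} → Antiperiodic S (p + q) → Periodic S q → Antiperiodic S p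
  antiperiodic-∸-period {p} {q} anti per j =
    trans (sym (per (j + p))) (trans (cong S (+-assoc j p q)) (anti j))

  not-periodic-and-antiperiodic : ∀ {p} → Periodic S p → Antiperiodic S p → ⊥
  not-periodic-and-antiperiodic per anti = not-¬ refl (trans (sym (per 0)) (anti 0))

antiperiodic-agree : ∀ {S T : ℕ → Bool} {p} → 1 ≤ p → Antiperiodic S p → Antiperiodic T p →
                     (∀ j → j < p → S j ≡ T j) → ∀ j → S j ≡ T j
antiperiodic-agree {S} {T} {p} p≥1 antiS antiT initial = <-rec (λ j → S j ≡ T j) step
  where
  step : ∀ j → (∀ {i} → i < j → S i ≡ T i) → S j ≡ T j
  step j below with j <? p
  ... | yes j<p = initial j j<p
  ... | no j≮p = begin
    S j              ≡⟨ cong S (sym j∸p+p) ⟩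
    S (j ∸ p + p)    ≡⟨ antiS (j ∸ p) ⟩
    not (S (j ∸ p))  ≡⟨ cong not (below (∸-monoʳ-< p≥1 p≤j)) ⟩
    not (T (j ∸ p))  ≡⟨ sym (antiT (j ∸ p)) ⟩
    T (j ∸ p + p)    ≡⟨ cong T j∸p+p ⟩
    T j              ∎
    where
    p≤j : p ≤ j
    p≤j = ≮⇒≥ j≮p
    j∸p+p : j ∸ p + p ≡ j
    j∸p+p = m∸n+n≡m p≤j

rotate : List Bool → List Bool
rotate []      = []
rotate (b ∷ l) = l ++ [ not b ]

-- The j-th letter of a word (false beyond its end).
at : List Bool → ℕ → Bool
at []      _       = false
at (b ∷ l) zero    = b
at (b ∷ l) (suc j) = at l j

stream : List Bool → ℕ → Bool
stream l j = at (iter j rotate l) 0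

length-rotate : ∀ l → length (rotate l) ≡ length l
length-rotate []      = refl
length-rotate (b ∷ l) = trans (length-++ l) (+-comm (length l) 1)

length-iter-rotate : ∀ k l → length (iter k rotate l) ≡ length l
length-iter-rotate zero    l = refl
length-iter-rotate (suc k) l = trans (length-rotate (iter k rotate l)) (length-iter-rotate k l)

rotate-past : ∀ xs ys → iter (length xs) rotate (xs ++ ys) ≡ ys ++ map not xs
rotate-past []       ys = sym (++-identityʳ ys)
rotate-past (x ∷ xs) ys = begin
  iter (suc (length xs)) rotate (x ∷ xs ++ ys)   ≡⟨ iter-suc rotate (length xs) _ ⟩
  iter (length xs) rotate ((xs ++ ys) ++ [ not x ]) ≡⟨ cong (iter (length xs) rotate) (++-assoc xs ys _) ⟩
  iter (length xs) rotate (xs ++ ys ++ [ not x ])   ≡⟨ rotate-past xs _ ⟩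
  (ys ++ [ not x ]) ++ map not xs                   ≡⟨ ++-assoc ys _ _ ⟩
  ys ++ map not (x ∷ xs)                            ∎

rotate-full : ∀ l → iter (length l) rotate l ≡ map not l
rotate-full l = trans (cong (iter (length l) rotate) (sym (++-identityʳ l))) (rotate-past l [])

rotate-not : ∀ l → rotate (map not l) ≡ map not (rotate l)
rotate-not []      = refl
rotate-not (b ∷ l) = sym (map-++ not l _)

rotate-injective : ∀ {x y} → rotate x ≡ rotate y → x ≡ y
rotate-injective {[]}    {[]}    e = refl
rotate-injective {[]}    {b ∷ y} e with () ← ++-conicalʳ y _ (sym e)
rotate-injective {a ∷ x} {[]}    e with () ← ++-conicalʳ x _ e
rotate-injective {a ∷ x} {b ∷ y} e with x≡y , na≡nb ← ∷ʳ-injective x y e =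
  cong₂ _∷_ (not-injective na≡nb) x≡y

stream-shift : ∀ l j i → stream l (j + i) ≡ stream (iter i rotate l) j
stream-shift l j i = cong (λ w → at w 0) (iter-+ rotate j i l)

stream-antiperiodic : ∀ l → 1 ≤ length l → Antiperiodic (stream l) (length l)
stream-antiperiodic l l≢[] j = begin
  stream l (j + length l)                        ≡⟨ stream-shift l j (length l) ⟩
  at (iter j rotate (iter (length l) rotate l)) 0 ≡⟨ cong (λ w → at (iter j rotate w) 0) (rotate-full l) ⟩
  at (iter j rotate (map not l)) 0               ≡⟨ cong (λ w → at w 0) (iter-commute rotate (map not) rotate-not j l) ⟩
  at (map not (iter j rotate l)) 0               ≡⟨ at-not (iter j rotate l) (subst (1 ≤_) (sym (length-iter-rotate j l)) l≢[]) ⟩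
  not (stream l j)                               ∎
  where
  at-not : ∀ w → 1 ≤ length w → at (map not w) 0 ≡ not (at w 0)
  at-not (b ∷ w) _ = refl

at-++ : ∀ l r j → j < length l → at (l ++ r) j ≡ at l j
at-++ (b ∷ l) r zero    _         = refl
at-++ (b ∷ l) r (suc j) (s≤s j<l) = at-++ l r j j<l

stream-at : ∀ l j → j < length l → stream l j ≡ at l j
stream-at (b ∷ l) zero    _         = refl
stream-at (b ∷ l) (suc j) (s≤s j<l) = begin
  stream (b ∷ l) (suc j)  ≡⟨ cong (λ w → at w 0) (iter-suc rotate j (b ∷ l)) ⟩
  stream (l ++ [ not b ]) j ≡⟨ stream-at (l ++ [ not b ]) j j<l++ ⟩
  at (l ++ [ not b ]) j   ≡⟨ at-++ l _ j j<l ⟩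
  at l j                  ∎
  where
  j<l++ : j < length (l ++ [ not b ])
  j<l++ = subst (j <_) (sym (length-rotate (b ∷ l))) (m<n⇒m<1+n j<l)

at-ext : ∀ l l' → length l ≡ length l' → (∀ j → j < length l → at l j ≡ at l' j) → l ≡ l'
at-ext []      []       _ _     = refl
at-ext (a ∷ l) (b ∷ l') e agree =
  cong₂ _∷_ (agree 0 (s≤s z≤n)) (at-ext l l' (suc-injective e) (λ j j<l → agree (suc j) (s≤s j<l)))

stream-ext : ∀ l l' → length l ≡ length l' → (∀ j → j < length l → stream l j ≡ stream l' j) → l ≡ l'
stream-ext l l' e agree = at-ext l l' e λ j j<l →
  trans (sym (stream-at l j j<l)) (trans (agree j j<l) (stream-at l' j (subst (j <_) e j<l)))

rotation-fixed⇒periodic : ∀ p l → iter p rotate l ≡ l → Periodic (stream l) p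
rotation-fixed⇒periodic p l fixed j = trans (stream-shift l j p) (cong (λ w → stream w j) fixed)

periodic⇒rotation-fixed : ∀ p l → Periodic (stream l) p → iter p rotate l ≡ l
periodic⇒rotation-fixed p l per = stream-ext _ l (length-iter-rotate p l) λ j _ →
  trans (sym (stream-shift l j p)) (per j)

toList-cancel : ∀ {k} (v w : BW k) → toList v ≡ toList w → v ≡ w
toList-cancel v w e = trans (sym (cast-is-id refl v)) (toList-injective refl v w e)

wordStream : ∀ {k} → BW k → ℕ → Bool
wordStream w = stream (toList w)

prefix : (k : ℕ) → (ℕ → Bool) → BW k
prefix zero    S = []
prefix (suc k) S = S 0 ∷ prefix k (λ j → S (suc j))

prefix-cong : ∀ k {S T : ℕ → Bool} → (∀ j → S j ≡ T j) → prefix k S ≡ prefix k T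
prefix-cong zero    eq = refl
prefix-cong (suc k) eq = cong₂ _∷_ (eq 0) (prefix-cong k (λ j → eq (suc j)))

wordStream-antiperiodic : ∀ {k} (w : BW k) → 1 ≤ k → Antiperiodic (wordStream w) k
wordStream-antiperiodic {k} w k≥1 =
  subst (Antiperiodic (wordStream w)) (length-toList w)
        (stream-antiperiodic (toList w) (subst (1 ≤_) (sym (length-toList w)) k≥1))

word-ext : ∀ {k} (v w : BW k) → (∀ j → j < k → wordStream v j ≡ wordStream w j) → v ≡ w
word-ext v w agree = toList-cancel v w
  (stream-ext (toList v) (toList w) (trans (length-toList v) (sym (length-toList w)))
              (λ j j<v → agree j (subst (j <_) (length-toList v) j<v)))

at-prefix : ∀ k S j → j < k → at (toList (prefix k S)) j ≡ S j
at-prefix (suc k) S zero    _         = refl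
at-prefix (suc k) S (suc j) (s≤s j<k) = at-prefix k (λ i → S (suc i)) j j<k

wordStream-prefix : ∀ k S j → j < k → wordStream (prefix k S) j ≡ S j
wordStream-prefix k S j j<k =
  trans (stream-at _ j (subst (j <_) (sym (length-toList (prefix k S))) j<k)) (at-prefix k S j j<k)

prefix-wordStream : ∀ {k} (w : BW k) → prefix k (wordStream w) ≡ w
prefix-wordStream {k} w = word-ext _ w (wordStream-prefix k (wordStream w))

wordStream-prefix-antiperiodic : ∀ k {S} → 1 ≤ k → Antiperiodic S k → ∀ j → wordStream (prefix k S) j ≡ S j
wordStream-prefix-antiperiodic k k≥1 anti =
  antiperiodic-agree k≥1 (wordStream-antiperiodic (prefix k _) k≥1) anti (wordStream-prefix k _)

-- η is undone by τ², so its fixed points are the 2m-periodic streams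

rotate² : List Bool → List Bool
rotate² l = rotate (rotate l)

-- τ² undoes η (for length 1, where η is the identity, τ² negates twice).
rotate-twice-η : ∀ {k} (w : BW k) → rotate² (toList (η w)) ≡ toList w
rotate-twice-η []          = refl
rotate-twice-η (b ∷ [])    = cong [_] (not-involutive b)
rotate-twice-η v@(_ ∷ _ ∷ _) = begin
  (toList (init (init v)) ++ [ not (not (last (init v))) ]) ++ [ not (not (last v)) ]
    ≡⟨ cong₂ (λ x y → (toList (init (init v)) ++ [ x ]) ++ [ y ]) (not-involutive _) (not-involutive _) ⟩
  (toList (init (init v)) ++ [ last (init v) ]) ++ [ last v ]
    ≡⟨ cong (_++ [ last v ]) (sym (toList-∷ʳ _ (init (init v)))) ⟩
  toList (init (init v) ∷ʳ last (init v)) ++ [ last v ]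
    ≡⟨ cong (λ u → toList u ++ [ last v ]) (sym (init-∷ʳ-last (init v))) ⟩
  toList (init v) ++ [ last v ]
    ≡⟨ sym (toList-∷ʳ _ (init v)) ⟩
  toList (init v ∷ʳ last v)
    ≡⟨ cong toList (sym (init-∷ʳ-last v)) ⟩
  toList v
    ∎
  where
  init-∷ʳ-last : ∀ {k} (u : BW (suc k)) → u ≡ init u ∷ʳ last u
  init-∷ʳ-last u = proj₂ (proj₂ (initLast u))

η-fixed⇒periodic : ∀ {k} m (w : BW k) → iter m η w ≡ w → Periodic (wordStream w) (2 * m)
η-fixed⇒periodic m w fixed = rotation-fixed⇒periodic (2 * m) (toList w) (begin
  iter (2 * m) rotate (toList w)                      ≡⟨ sym (iter-twice rotate m _) ⟩
  iter m rotate² (toList w)                           ≡⟨ cong (λ v → iter m rotate² (toList v)) (sym fixed) ⟩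
  iter m rotate² (toList (iter m η w))                ≡⟨ iter-undo toList η rotate² rotate-twice-η m w ⟩
  toList w                                            ∎)

periodic⇒η-fixed : ∀ {k} m (w : BW k) → Periodic (wordStream w) (2 * m) → iter m η w ≡ w
periodic⇒η-fixed m w per = toList-cancel _ w
  (iter-injective rotate rotate-injective (2 * m) (begin
    iter (2 * m) rotate (toList (iter m η w))  ≡⟨ sym (iter-twice rotate m _) ⟩
    iter m rotate² (toList (iter m η w))       ≡⟨ iter-undo toList η rotate² rotate-twice-η m w ⟩
    toList w                                   ≡⟨ sym (periodic⇒rotation-fixed (2 * m) (toList w) per) ⟩
    iter (2 * m) rotate (toList w)             ∎))

allWords-complete : ∀ n (w : BW n) → w ∈ allWords n
allWords-complete zero    []          = here refl
allWords-complete (suc n) (false ∷ w) = ∈-++⁺ˡ (∈-map⁺ (false ∷_) (allWords-complete n w))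
allWords-complete (suc n) (true ∷ w)  =
  ∈-++⁺ʳ (map (false ∷_) (allWords n)) (∈-map⁺ (true ∷_) (allWords-complete n w))

allWords-length : ∀ n → length (allWords n) ≡ 2 ^ n
allWords-length zero    = refl
allWords-length (suc n) = begin
  length (map (false ∷_) (allWords n) ++ map (true ∷_) (allWords n))
    ≡⟨ length-++ (map (false ∷_) (allWords n)) ⟩
  length (map (false ∷_) (allWords n)) + length (map (true ∷_) (allWords n))
    ≡⟨ cong₂ _+_ (length-map _ (allWords n)) (length-map _ (allWords n)) ⟩
  length (allWords n) + length (allWords n)
    ≡⟨ cong (λ k → k + k) (allWords-length n) ⟩
  2 ^ n + 2 ^ n
    ≡⟨ cong (2 ^ n +_) (sym (+-identityʳ (2 ^ n))) ⟩
  2 ^ suc n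
    ∎

allWords-unique : ∀ n → Unique (allWords n)
allWords-unique zero    = All.[] ∷ []
allWords-unique (suc n) =
  Unique.++⁺ (Unique.map⁺ tail-injective (allWords-unique n))
             (Unique.map⁺ tail-injective (allWords-unique n))
             disjoint
  where
  tail-injective : ∀ {b} {v w : BW n} → b ∷ v ≡ b ∷ w → v ≡ w
  tail-injective e = proj₂ (∷-injective e)
  disjoint : ∀ {v} → v ∈ map (false ∷_) (allWords n) × v ∈ map (true ∷_) (allWords n) → ⊥
  disjoint (p , q) with ∈-map⁻ (false ∷_) p | ∈-map⁻ (true ∷_) q
  ... | _ , _ , refl | _ , _ , ()

count-by-retraction : ∀ {n d} {P : Pred (BW n) 0ℓ} (P? : Decidable P)
                      (f : BW d → BW n) (g : BW n → BW d) →
                      (∀ u → g (f u) ≡ u) → (∀ u → P (f u)) → (∀ w → P w → f (g w) ≡ w) →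
                      length (filter P? (allWords n)) ≡ 2 ^ d
count-by-retraction {n} {d} P? f g gf≡id image⊆P P⊆image = begin
  length (filter P? (allWords n))  ≡⟨ ↭-length (∼bag⇒↭ (unique∧set⇒bag unique-filter unique-image same-elements)) ⟩
  length (map f (allWords d))      ≡⟨ length-map f (allWords d) ⟩
  length (allWords d)              ≡⟨ allWords-length d ⟩
  2 ^ d                            ∎
  where
  f-injective : ∀ {u v} → f u ≡ f v → u ≡ v
  f-injective {u} {v} e = trans (sym (gf≡id u)) (trans (cong g e) (gf≡id v))
  unique-filter : Unique (filter P? (allWords n))
  unique-filter = Unique.filter⁺ P? (allWords-unique n)
  unique-image : Unique (map f (allWords d))
  unique-image = Unique.map⁺ f-injective (allWords-unique d)
  to : ∀ {w} → w ∈ filter P? (allWords n) → w ∈ map f (allWords d)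
  to {w} w∈ with _ , Pw ← ∈-filter⁻ P? {xs = allWords n} w∈ =
    subst (_∈ map f (allWords d)) (P⊆image w Pw) (∈-map⁺ f (allWords-complete d (g w)))
  from : ∀ {w} → w ∈ map f (allWords d) → w ∈ filter P? (allWords n)
  from w∈ with u , _ , refl ← ∈-map⁻ f w∈ = ∈-filter⁺ P? (allWords-complete n (f u)) (image⊆P u)
  same-elements : filter P? (allWords n) ∼[ set ] map f (allWords d)
  same-elements {w} = mk⇔ (to {w}) (from {w})

parity-split : ∀ t d → t * d ≡ t % 2 * d + t / 2 * (2 * d)
parity-split t d = begin
  t * d                          ≡⟨ cong (_* d) (m≡m%n+[m/n]*n t 2) ⟩
  (t % 2 + t / 2 * 2) * d        ≡⟨ solve 3 (λ r q d → (r :+ q :* con 2) :* d := r :* d :+ q :* (con 2 :* d))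
                                          refl (t % 2) (t / 2) d ⟩
  t % 2 * d + t / 2 * (2 * d)    ∎
  where open +-*-Solver

odd-split : ∀ t d → t % 2 ≡ 1 → t * d ≡ d + t / 2 * (2 * d)
odd-split t d t-odd =
  trans (parity-split t d) (cong (_+ t / 2 * (2 * d)) (trans (cong (_* d) t-odd) (*-identityˡ d)))

even-split : ∀ t d → t % 2 ≡ 0 → t * d ≡ t / 2 * (2 * d)
even-split t d t-even = trans (parity-split t d) (cong (λ r → r * d + t / 2 * (2 * d)) t-even)

module _ {S : ℕ → Bool} {d : ℕ} where

  antiperiodic-odd-multiple : ∀ t → t % 2 ≡ 1 → Antiperiodic S d → Antiperiodic S (t * d)
  antiperiodic-odd-multiple t t-odd anti =
    subst (Antiperiodic S) (sym (odd-split t d t-odd))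
          (antiperiodic-+-period anti (periodic-multiple (antiperiodic-double anti) (t / 2)))

  antiperiodic-odd-divisor : ∀ t → t % 2 ≡ 1 → Periodic S (2 * d) → Antiperiodic S (t * d) → Antiperiodic S d
  antiperiodic-odd-divisor t t-odd per anti =
    antiperiodic-∸-period (subst (Antiperiodic S) (odd-split t d t-odd) anti) (periodic-multiple per (t / 2))

  periodic-even-multiple : ∀ t → t % 2 ≡ 0 → Periodic S (2 * d) → Periodic S (t * d)
  periodic-even-multiple t t-even per =
    subst (Periodic S) (sym (even-split t d t-even)) (periodic-multiple per (t / 2))

  antiperiodic-divisor-periodic : ∀ {m} → d ∣ m → Antiperiodic S d → Periodic S (2 * m)
  antiperiodic-divisor-periodic (divides q refl) anti =
    subst (Periodic S) (solve 2 (λ q d → q :* (con 2 :* d) := con 2 :* (q :* d)) refl q d)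
          (periodic-multiple (antiperiodic-double anti) q)
    where open +-*-Solver

periodic-collapse : ∀ {S} m n → Antiperiodic S n → Periodic S (2 * m) → Periodic S (2 * gcd m n)
periodic-collapse {S} m n anti per =
  subst (Periodic S) (sym (c*gcd[m,n]≡gcd[cm,cn] 2 m n)) (periodic-gcd per (antiperiodic-double anti))

module FixedWords (n m : ℕ) (n≥1 : 1 ≤ n) where

  d t : ℕ
  d = gcd m n
  t = nOverGcd m n n≥1

  instance
    d-nonZero : NonZero d
    d-nonZero = ≢-nonZero (gcd[m,n]≢0 m n (inj₂ (≢-nonZero⁻¹ n {{>-nonZero n≥1}})))

  d≥1 : 1 ≤ d
  d≥1 = >-nonZero⁻¹ d

  t*d≡n : t * d ≡ n
  t*d≡n = m/n*n≡m (gcd[m,n]∣n m n)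

  Fixed : BW n → Set
  Fixed w = iter m η w ≡ w

  Fixed? : Decidable Fixed
  Fixed? w = ≡-dec BoolP._≟_ (iter m η w) w

  fixed-antiperiodic : ∀ w → Antiperiodic (wordStream w) (t * d)
  fixed-antiperiodic w = subst (Antiperiodic (wordStream w)) (sym t*d≡n) (wordStream-antiperiodic w n≥1)

  fixed-periodic : ∀ w → Fixed w → Periodic (wordStream w) (2 * d)
  fixed-periodic w fixed = periodic-collapse m n (wordStream-antiperiodic w n≥1) (η-fixed⇒periodic m w fixed)

  no-fixed-word : t % 2 ≡ 0 → ∀ w → ¬ Fixed w
  no-fixed-word t-even w fixed = not-periodic-and-antiperiodic
    (periodic-even-multiple t t-even (fixed-periodic w fixed)) (fixed-antiperiodic w)

  module _ (t-odd : t % 2 ≡ 1) where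

    extend : BW d → BW n
    extend u = prefix n (wordStream u)

    restrict : BW n → BW d
    restrict w = prefix d (wordStream w)

    extend-stream : ∀ u j → wordStream (extend u) j ≡ wordStream u j
    extend-stream u = wordStream-prefix-antiperiodic n n≥1
      (subst (Antiperiodic (wordStream u)) t*d≡n (antiperiodic-odd-multiple t t-odd (wordStream-antiperiodic u d≥1)))

    restrict-extend : ∀ u → restrict (extend u) ≡ u
    restrict-extend u = trans (prefix-cong d (extend-stream u)) (prefix-wordStream u)

    extend-fixed : ∀ u → Fixed (extend u)
    extend-fixed u = periodic⇒η-fixed m (extend u) λ j → begin
      wordStream (extend u) (j + 2 * m)  ≡⟨ extend-stream u (j + 2 * m) ⟩
      wordStream u (j + 2 * m)           ≡⟨ antiperiodic-divisor-periodic (gcd[m,n]∣m m n) (wordStream-antiperiodic u d≥1) j ⟩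
      wordStream u j                     ≡⟨ sym (extend-stream u j) ⟩
      wordStream (extend u) j            ∎

    extend-restrict : ∀ w → Fixed w → extend (restrict w) ≡ w
    extend-restrict w fixed = trans (prefix-cong n restrict-stream) (prefix-wordStream w)
      where
      restrict-stream : ∀ j → wordStream (restrict w) j ≡ wordStream w j
      restrict-stream = wordStream-prefix-antiperiodic d d≥1
        (antiperiodic-odd-divisor t t-odd (fixed-periodic w fixed) (fixed-antiperiodic w))

lemma6p1 : (n m : ℕ) → (hn : 1 ≤ n) → 1 ≤ m →
    (nOverGcd m n hn % 2 ≡ 1 → numFixed n m ≡ 2 ^ gcd m n) ×
    (nOverGcd m n hn % 2 ≡ 0 → numFixed n m ≡ 0)
lemma6p1 n m hn _ = odd-count , even-count
  where
  open FixedWords n m hn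

  odd-count : t % 2 ≡ 1 → numFixed n m ≡ 2 ^ d
  odd-count t-odd = count-by-retraction Fixed? (extend t-odd) (restrict t-odd)
    (restrict-extend t-odd) (extend-fixed t-odd) (extend-restrict t-odd)

  even-count : t % 2 ≡ 0 → numFixed n m ≡ 0
  even-count t-even = cong length (filter-none Fixed? {xs = allWords n} (All.tabulate λ {w} _ → no-fixed-word t-even w))
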